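{- (1) A set $S\subseteq\mathbb{Z}^n$ is M-convex if and only if it is both M$_2$-convex and M$^\natural$-convex. (2) A function $f:\mathbb{Z}^n\to\mathbb{R}\cup\{+\infty\}$ is M-convex if and only if it is both M$_2$-convex and M$^\natural$-convex.
   Context: $e_i$ is the $i$th unit vector, $e_0=\mathbf{0}$, $\mathrm{supp}^+(z)=\{i:z_i>0\}$, $\mathrm{supp}^-(z)=\{i:z_i<0\}$; functions $f:\mathbb{Z}^n\to\mathbb{R}\cup\{+\infty\}$ have nonempty effective domain $\operatorname{dom} f=\{x:f(x)<+\infty\}$. A function $f$ is M$^\natural$-convex if for all $x,y\in\operatorname{dom} f$ and $i\in\mathrm{supp}^+(x-y)$: $f(x)+f(y)\ge\min_{j\in\mathrm{supp}^-(x-y)\cup\{0\}}\{f(x-e_i+e_j)+f(y+e_i-e_j)\}$. A nonempty set $S$ is M$^\natural$-convex if for $x,y\in S$, $i\in\mathrm{supp}^+(x-y)$: either $x-e_i,y+e_i\in S$, or some $j\in\mathrm{supp}^-(x-y)$ has $x-e_i+e_j,\,y+e_i-e_j\in S$. A nonempty set $S$ is M-convex if for $x,y\in S$, $i\in\mathrm{supp}^+(x-y)$ there is $j\in\mathrm{supp}^-(x-y)$ with $x-e_i+e_j,\,y+e_i-e_j\in S$. A function is M-convex if it is M$^\natural$-convex and its effective domain is an M-convex set. A nonempty set is M$_2$-convex if it is the intersection of two M-convex sets. A function is M$_2$-convex if it is the sum $f_1+f_2$ of two M-convex functions (with nonempty effective domain). -}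

module Defs where

open import Data.Nat using (ℕ)
open import Data.Integer as ℤ using (ℤ; 0ℤ; 1ℤ)
open import Data.Fin using (Fin; _≟_)
open import Data.Maybe using (Maybe; just; nothing)
open import Data.Product using (Σ; ∃; ∃-syntax; _×_)
open import Data.Sum using (_⊎_)
open import Data.Unit using (⊤)
open import Relation.Nullary using (yes; no)
open import Relation.Binary.PropositionalEquality using (_≡_)
open import Relation.Binary.Structures using (IsTotalOrder)
open import Function.Bundles using (_⇔_)

-- Value domain.  ℝ is not available in agda-stdlib; we work over an
-- arbitrary totally ordered abelian group (ℝ being one instance).

record OrderedAbelianGroup : Set₁ where
  infixl 6 _+_
  infix  4 _≤_
  field
    Carrier     : Set
    _+_         : Carrier → Carrier → Carrier
    0#          : Carrier
    -_          : Carrier → Carrier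
    _≤_         : Carrier → Carrier → Set
    isTotalOrder : IsTotalOrder _≡_ _≤_
    +-assoc     : ∀ a b c → (a + b) + c ≡ a + (b + c)
    +-comm      : ∀ a b → a + b ≡ b + a
    +-identityʳ : ∀ a → a + 0# ≡ a
    +-inverseʳ  : ∀ a → a + (- a) ≡ 0#
    +-monoˡ-≤   : ∀ {a b} c → a ≤ b → a + c ≤ b + c

ZVec : ℕ → Set
ZVec n = Fin n → ℤ

infixl 6 _⊕_ _⊖_

_⊕_ : ∀ {n} → ZVec n → ZVec n → ZVec n
(x ⊕ y) k = x k ℤ.+ y k

_⊖_ : ∀ {n} → ZVec n → ZVec n → ZVec n
(x ⊖ y) k = x k ℤ.- y k

-- e (just i) is the i-th unit vector; e nothing is e₀ = 0.
e : ∀ {n} → Maybe (Fin n) → ZVec n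
e nothing  k = 0ℤ
e (just i) k with i ≟ k
... | yes _ = 1ℤ
... | no  _ = 0ℤ

InSupp⁺ : ∀ {n} → ZVec n → Fin n → Set
InSupp⁺ z i = 0ℤ ℤ.< z i

InSupp⁻ : ∀ {n} → ZVec n → Fin n → Set
InSupp⁻ z j = z j ℤ.< 0ℤ

InSupp⁻₀ : ∀ {n} → ZVec n → Maybe (Fin n) → Set
InSupp⁻₀ z nothing  = ⊤
InSupp⁻₀ z (just j) = InSupp⁻ z j

Nonempty : ∀ {n} → (ZVec n → Set) → Set
Nonempty S = ∃[ x ] S x

IsMnatSet : ∀ {n} → (ZVec n → Set) → Set
IsMnatSet {n} S =
  Nonempty S ×
  (∀ x y → S x → S y → ∀ (i : Fin n) → InSupp⁺ (x ⊖ y) i →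
     (S (x ⊖ e (just i)) × S (y ⊕ e (just i)))
     ⊎ (∃[ j ] InSupp⁻ (x ⊖ y) j
          × S (x ⊖ e (just i) ⊕ e (just j))
          × S (y ⊕ e (just i) ⊖ e (just j))))

IsMSet : ∀ {n} → (ZVec n → Set) → Set
IsMSet {n} S =
  Nonempty S ×
  (∀ x y → S x → S y → ∀ (i : Fin n) → InSupp⁺ (x ⊖ y) i →
     ∃[ j ] InSupp⁻ (x ⊖ y) j
          × S (x ⊖ e (just i) ⊕ e (just j))
          × S (y ⊕ e (just i) ⊖ e (just j)))

IsM₂Set : ∀ {n} → (ZVec n → Set) → Set₁
IsM₂Set {n} S =
  Nonempty S ×
  (∃[ S₁ ] ∃[ S₂ ] IsMSet {n} S₁ × IsMSet {n} S₂ × (∀ x → S x ⇔ (S₁ x × S₂ x)))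

module _ (G : OrderedAbelianGroup) where
  open OrderedAbelianGroup G

  data R∞ : Set where
    fin : Carrier → R∞
    ∞   : R∞

  infixl 6 _+∞_
  _+∞_ : R∞ → R∞ → R∞
  fin a +∞ fin b = fin (a + b)
  fin a +∞ ∞     = ∞
  ∞     +∞ _     = ∞

  infix 4 _≤∞_
  data _≤∞_ : R∞ → R∞ → Set where
    fin≤fin : ∀ {a b} → a ≤ b → fin a ≤∞ fin b
    any≤∞   : ∀ {u} → u ≤∞ ∞

  dom : ∀ {n} → (ZVec n → R∞) → ZVec n → Set
  dom f x = ∃[ r ] f x ≡ fin r

  -- f(x)+f(y) ≥ min_{j ∈ supp⁻(x-y) ∪ {0}} {f(x-eᵢ+eⱼ)+f(y+eᵢ-eⱼ)},
  -- the min over a finite nonempty set in a total order being attained.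
  IsMnatFun : ∀ {n} → (ZVec n → R∞) → Set
  IsMnatFun {n} f =
    ∀ x y → dom f x → dom f y → ∀ (i : Fin n) → InSupp⁺ (x ⊖ y) i →
      ∃[ j ] InSupp⁻₀ (x ⊖ y) j
        × (f (x ⊖ e (just i) ⊕ e j) +∞ f (y ⊕ e (just i) ⊖ e j) ≤∞ f x +∞ f y)

  IsMFun : ∀ {n} → (ZVec n → R∞) → Set
  IsMFun f = IsMnatFun f × IsMSet (dom f)

  IsM₂Fun : ∀ {n} → (ZVec n → R∞) → Set
  IsM₂Fun {n} f =
    ∃[ f₁ ] ∃[ f₂ ] IsMFun {n} f₁ × IsMFun {n} f₂ × (∀ x → f x ≡ f₁ x +∞ f₂ x)

-- An M-convex set never contains two points x and x − eᵢ: exchanging at i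
-- would need a negative coordinate of x − (x − eᵢ) = eᵢ.  In an M₂-convex set,
-- which lies inside an M-convex one, the first alternative of the M♮-exchange
-- (and, for functions, the choice j = 0) is therefore impossible, so M♮-exchange
-- is already M-exchange.  Conversely an M-convex set is the intersection S ∩ S,
-- and an M-convex function f is f + δ, where δ is the indicator function of dom f.
module Submission where

open import Defs
open import Data.Nat using (ℕ; z≤n; s≤s)
open import Data.Integer as ℤ using (ℤ; 0ℤ; 1ℤ; +≤+; +<+)
import Data.Integer.Properties as ℤ
open import Data.Integer.Tactic.RingSolver using (solve-∀)
open import Data.Fin using (Fin; _≟_)
open import Data.Maybe using (just; nothing)
open import Data.Product using (_×_; _,_; proj₁; proj₂; ∃-syntax)
open import Data.Sum using (inj₁; inj₂)
open import Data.Empty using (⊥; ⊥-elim)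
open import Function.Bundles using (_⇔_; mk⇔; Equivalence)
open import Relation.Nullary using (yes; no)
open import Relation.Unary using (_⊆_; _≐_)
open import Relation.Binary.PropositionalEquality using (_≡_; refl; sym; cong; subst)
open import Relation.Binary.Structures using (IsTotalOrder)

private
  variable
    n : ℕ

i-[i-j]≡j : ∀ (i j : ℤ) → i ℤ.- (i ℤ.- j) ≡ j
i-[i-j]≡j = solve-∀

i-[[i-j]+0]≡j : ∀ (i j : ℤ) → i ℤ.- ((i ℤ.- j) ℤ.+ 0ℤ) ≡ j
i-[[i-j]+0]≡j = solve-∀

e-diag : (i : Fin n) → e (just i) i ≡ 1ℤ
e-diag i with i ≟ i
... | yes _  = refl
... | no i≢i = ⊥-elim (i≢i refl)

0≤e : (i k : Fin n) → 0ℤ ℤ.≤ e (just i) k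
0≤e i k with i ≟ k
... | yes _ = +≤+ z≤n
... | no  _ = +≤+ z≤n

IsMSet⇒no-unit-step : ∀ {T : ZVec n → Set} → IsMSet T →
                      ∀ {x z} i → (∀ k → (x ⊖ z) k ≡ e (just i) k) → T x → T z → ⊥
IsMSet⇒no-unit-step (_ , exchange) {x} {z} i x-z≡eᵢ tx tz
  with exchange x z tx tz i (subst (0ℤ ℤ.<_) (sym x-z≡eᵢ-at-i) (+<+ (s≤s z≤n)))
  where
  x-z≡eᵢ-at-i : (x ⊖ z) i ≡ 1ℤ
  x-z≡eᵢ-at-i = subst ((x ⊖ z) i ≡_) (e-diag i) (x-z≡eᵢ i)
... | j , [x-z]ⱼ<0 , _ = ℤ.<⇒≱ (subst (ℤ._< 0ℤ) (x-z≡eᵢ j) [x-z]ⱼ<0) (0≤e i j)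

IsMSet⇒IsMnatSet : ∀ {S : ZVec n → Set} → IsMSet S → IsMnatSet S
IsMSet⇒IsMnatSet (ne , exchange) = ne , λ x y sx sy i i∈supp⁺ → inj₂ (exchange x y sx sy i i∈supp⁺)

IsMSet⇒IsM₂Set : ∀ {S : ZVec n → Set} → IsMSet S → IsM₂Set S
IsMSet⇒IsM₂Set {S = S} m@(ne , _) = ne , S , S , m , m , λ _ → mk⇔ (λ s → s , s) proj₁

IsM₂Set⇒⊆IsMSet : ∀ {S : ZVec n → Set} → IsM₂Set S → ∃[ T ] IsMSet T × S ⊆ T
IsM₂Set⇒⊆IsMSet (_ , S₁ , _ , m₁ , _ , S≐S₁∩S₂) = S₁ , m₁ , λ {x} s → proj₁ (Equivalence.to (S≐S₁∩S₂ x) s)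

IsMnatSet⇒IsMSet : ∀ {S T : ZVec n → Set} → IsMSet T → S ⊆ T → IsMnatSet S → IsMSet S
IsMnatSet⇒IsMSet {S = S} mT S⊆T (ne , exchange) = ne , exchange′
  where
  exchange′ : ∀ x y → S x → S y → ∀ i → InSupp⁺ (x ⊖ y) i →
              ∃[ j ] InSupp⁻ (x ⊖ y) j × S (x ⊖ e (just i) ⊕ e (just j)) × S (y ⊕ e (just i) ⊖ e (just j))
  exchange′ x y sx sy i i∈supp⁺ with exchange x y sx sy i i∈supp⁺
  ... | inj₂ r        = r
  ... | inj₁ (s , _) = ⊥-elim (IsMSet⇒no-unit-step mT i (λ k → i-[i-j]≡j (x k) _) (S⊆T sx) (S⊆T s))

IsMSet-resp-≐ : ∀ {S T : ZVec n → Set} → S ≐ T → IsMSet S → IsMSet T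
IsMSet-resp-≐ (S⊆T , T⊆S) ((x , sx) , exchange) = (x , S⊆T sx) , λ x y tx ty i i∈supp⁺ →
  let (j , j∈supp⁻ , s₁ , s₂) = exchange x y (T⊆S tx) (T⊆S ty) i i∈supp⁺
  in j , j∈supp⁻ , S⊆T s₁ , S⊆T s₂

MSet-theorem : (S : ZVec n → Set) → IsMSet S ⇔ (IsM₂Set S × IsMnatSet S)
MSet-theorem S = mk⇔ (λ m → IsMSet⇒IsM₂Set m , IsMSet⇒IsMnatSet m) from
  where
  from : IsM₂Set S × IsMnatSet S → IsMSet S
  from (m₂ , mnat) = let (T , mT , S⊆T) = IsM₂Set⇒⊆IsMSet m₂ in IsMnatSet⇒IsMSet mT S⊆T mnat

module _ (G : OrderedAbelianGroup) where
  open OrderedAbelianGroup G using (0#; +-identityʳ; isTotalOrder)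

  Finite : R∞ G → Set
  Finite u = ∃[ r ] u ≡ fin r

  +∞-finiteˡ : ∀ u v → Finite (_+∞_ G u v) → Finite u
  +∞-finiteˡ (fin a) _ _       = a , refl
  +∞-finiteˡ ∞       _ (_ , ())

  +∞-finiteʳ : ∀ u v → Finite (_+∞_ G u v) → Finite v
  +∞-finiteʳ (fin _) (fin b) _       = b , refl
  +∞-finiteʳ (fin _) ∞       (_ , ())
  +∞-finiteʳ ∞       _       (_ , ())

  +∞-finite : ∀ {u v} → Finite u → Finite v → Finite (_+∞_ G u v)
  +∞-finite (a , refl) (b , refl) = _ , refl

  ≤∞-finite : ∀ {u v} → _≤∞_ G u v → Finite v → Finite u
  ≤∞-finite (fin≤fin {a} _) _       = a , refl
  ≤∞-finite any≤∞           (_ , ())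

  domIndicator : (ZVec n → R∞ G) → ZVec n → R∞ G
  domIndicator f x with f x
  ... | fin _ = fin 0#
  ... | ∞     = ∞

  domIndicator-dom : ∀ (f : ZVec n → R∞ G) {x} → dom G f x → domIndicator f x ≡ fin 0#
  domIndicator-dom f {x} x∈dom with f x
  domIndicator-dom f (_ , refl) | fin _ = refl

  dom-domIndicator : ∀ (f : ZVec n → R∞ G) → dom G f ≐ dom G (domIndicator f)
  dom-domIndicator f = (λ d → 0# , domIndicator-dom f d) , from
    where
    from : dom G (domIndicator f) ⊆ dom G f
    from {x} d with f x
    from _        | fin a = a , refl
    from (_ , ()) | ∞

  f≡f+domIndicator : ∀ (f : ZVec n → R∞ G) x → f x ≡ _+∞_ G (f x) (domIndicator f x)
  f≡f+domIndicator f x with f x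
  ... | fin a = cong fin (sym (+-identityʳ a))
  ... | ∞     = refl

  domIndicator-IsMFun : ∀ (f : ZVec n → R∞ G) → IsMSet (dom G f) → IsMFun G (domIndicator f)
  domIndicator-IsMFun f mdom@(_ , exchange) = mnat , IsMSet-resp-≐ (dom-domIndicator f) mdom
    where
    zero-sum : ∀ {a b c d} → a ≡ fin 0# → b ≡ fin 0# → c ≡ fin 0# → d ≡ fin 0# →
               _≤∞_ G (_+∞_ G a b) (_+∞_ G c d)
    zero-sum refl refl refl refl = fin≤fin (IsTotalOrder.refl isTotalOrder)
    mnat : IsMnatFun G (domIndicator f)
    mnat x y dx dy i i∈supp⁺ =
      let from = proj₂ (dom-domIndicator f)
          (j , j∈supp⁻ , d₁ , d₂) = exchange x y (from dx) (from dy) i i∈supp⁺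
      in just j , j∈supp⁻ , zero-sum (domIndicator-dom f d₁) (domIndicator-dom f d₂)
                                     (domIndicator-dom f (from dx)) (domIndicator-dom f (from dy))

  IsMFun⇒IsM₂Fun : ∀ {f : ZVec n → R∞ G} → IsMFun G f → IsM₂Fun G f
  IsMFun⇒IsM₂Fun {f = f} mf@(_ , mdom) =
    f , domIndicator f , mf , domIndicator-IsMFun f mdom , f≡f+domIndicator f

  IsM₂Fun⇒dom⊆IsMSet : ∀ {f : ZVec n → R∞ G} → IsM₂Fun G f → ∃[ T ] IsMSet T × dom G f ⊆ T
  IsM₂Fun⇒dom⊆IsMSet {f = f} (f₁ , f₂ , (_ , mdom₁) , _ , f≡f₁+f₂) =
    dom G f₁ , mdom₁ , λ {x} d → +∞-finiteˡ (f₁ x) (f₂ x) (subst Finite (f≡f₁+f₂ x) d)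

  IsMnatFun⇒IsMFun : ∀ {f : ZVec n → R∞ G} {T : ZVec n → Set} →
                     IsMSet T → dom G f ⊆ T → Nonempty (dom G f) → IsMnatFun G f → IsMFun G f
  IsMnatFun⇒IsMFun {n} {f} mT dom⊆T ne mnat = mnat , ne , exchange
    where
    exchange : ∀ x y → dom G f x → dom G f y → ∀ (i : Fin n) → InSupp⁺ (x ⊖ y) i →
               ∃[ j ] InSupp⁻ (x ⊖ y) j
                 × dom G f (x ⊖ e (just i) ⊕ e (just j))
                 × dom G f (y ⊕ e (just i) ⊖ e (just j))
    exchange x y dx dy i i∈supp⁺ with mnat x y dx dy i i∈supp⁺
    ... | j , j∈supp⁻₀ , ≤fx+fy = pick j j∈supp⁻₀ (+∞-finiteˡ _ _ finite) (+∞-finiteʳ _ _ finite)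
      where
      finite : Finite (_+∞_ G (f (x ⊖ e (just i) ⊕ e j)) (f (y ⊕ e (just i) ⊖ e j)))
      finite = ≤∞-finite ≤fx+fy (+∞-finite dx dy)
      pick : ∀ j → InSupp⁻₀ (x ⊖ y) j → dom G f (x ⊖ e (just i) ⊕ e j) → dom G f (y ⊕ e (just i) ⊖ e j) →
             ∃[ j ] InSupp⁻ (x ⊖ y) j
               × dom G f (x ⊖ e (just i) ⊕ e (just j))
               × dom G f (y ⊕ e (just i) ⊖ e (just j))
      pick (just j) j∈supp⁻ d₁ d₂ = j , j∈supp⁻ , d₁ , d₂
      pick nothing  _       d₁ _  =
        ⊥-elim (IsMSet⇒no-unit-step mT i (λ k → i-[[i-j]+0]≡j (x k) _) (dom⊆T dx) (dom⊆T d₁))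

  MFun-theorem : ∀ (f : ZVec n → R∞ G) → Nonempty (dom G f) → IsMFun G f ⇔ (IsM₂Fun G f × IsMnatFun G f)
  MFun-theorem f ne = mk⇔ (λ mf → IsMFun⇒IsM₂Fun mf , proj₁ mf) from
    where
    from : IsM₂Fun G f × IsMnatFun G f → IsMFun G f
    from (m₂ , mnat) = let (T , mT , dom⊆T) = IsM₂Fun⇒dom⊆IsMSet m₂ in IsMnatFun⇒IsMFun mT dom⊆T ne mnat

theorem4p2 : (∀ (n : ℕ) (S : ZVec n → Set) → IsMSet S ⇔ (IsM₂Set S × IsMnatSet S))
    × (∀ (G : OrderedAbelianGroup) (n : ℕ) (f : ZVec n → R∞ G) →
    Nonempty (dom G f) →
    IsMFun G f ⇔ (IsM₂Fun G f × IsMnatFun G f))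
theorem4p2 = (λ _ → MSet-theorem) , (λ G _ → MFun-theorem G)
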